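{- Let $H$ be a connected graph, let $\mathbb G$ be a linear graph, let $\mathbf H \in \mathcal H$ be a pattern relaxation of $H$, let $\mathbb K$ be a linear piece of $\mathbf H$, let $z$ be the maximum vertex of $\mathbb K$ and let $x$ be any vertex of $\mathbb K$ with $x <_{\mathbb K} z$. Then there exists a vertex $y \in V(\mathbb K)$ with $x <_{\mathbb K} y \leq_{\mathbb K} z$ such that for every embedding $\phi$ of $\mathbf H$ into $\mathbb G$ it holds that $\phi(x) \in S^{|H|}_{\mathbb G}[\phi(y)]$, where $|H|$ is the number of vertices of $H$.
   Context: A tree order on a finite set $S$ is a partial order $\preccurlyeq$ such that for every $x$ the set $\{y : y \preccurlyeq x\}$ is totally ordered. A tree-ordered graph (tog) $\mathbf G = (G, \preccurlyeq_{\mathbf G})$ is a finite graph with a tree order on $V(G)$ such that every edge $uv$ has $u \preccurlyeq_{\mathbf G} v$ or $v \preccurlyeq_{\mathbf G} u$; if the order is total it is a linear graph (written $\mathbb G$, order $\leq_{\mathbb G}$). For $X \subseteq V(\mathbf G)$, $\mathbf G[X] = (G[X], \preccurlyeq_{\mathbf G}|_X)$. The root path of $x$ is $\{y : y \preccurlyeq_{\mathbf G} x\}$ and the leaves of $\mathbf G$ are its $\preccurlyeq_{\mathbf G}$-maximal vertices. For a connected linear graph $\mathbb H$, its elimination tree $\operatorname{ET}(\mathbb H)$ is: root $x = \min \mathbb H$, whose children are the roots of $\operatorname{ET}(\mathbb K_i)$ for the connected components $\mathbb K_i$ of $\mathbb H - x$; $\operatorname{rel}(\mathbb H)$ is the tog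 $(H, \preccurlyeq)$ with $u \preccurlyeq v$ iff $u$ is an ancestor of or equal to $v$ in $\operatorname{ET}(\mathbb H)$. For a connected graph $H$, the set of pattern relaxations is $\mathcal H = \{\operatorname{rel}((H, \leq)) : \leq \text{ a linear order of } V(H)\}$. For $\mathbf H \in \mathcal H$ and a nonempty set $S$ of leaves of $\mathbf H$, the piece induced by $S$ is $\mathbf H[\bigcup_{x \in S} \text{rootpath}(x)]$; if $|S| = 1$ it is linearly ordered (order $\leq_{\mathbb K}$) and called a linear piece. An embedding of a tog $\mathbf H$ into a tog $\mathbf G$ is an injective map $\phi: V(H) \to V(G)$ such that $uv \in E(H) \iff \phi(u)\phi(v) \in E(G)$ and $u \preccurlyeq_{\mathbf H} v \implies \phi(u) \preccurlyeq_{\mathbf G} \phi(v)$. For a linear graph $\mathbb G$, a vertex $u$ and integer $r$, $S^r_{\mathbb G}(u)$ is the set of vertices $v \leq_{\mathbb G} u$ for which there exists a $u$-$v$-path $P$ in $G$ with at most $r$ edges such that $u \leq_{\mathbb G} w$ for all $w \in V(P) \setminus \{v\}$; $S^r_{\mathbb G}[u] = S^r_{\mathbb G}(u) \cup \{u\}$. -}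

module Defs where

open import Data.Nat using (ℕ; zero; suc; _≤_; _<_)
open import Data.Fin using (Fin; _≟_) renaming (_≤_ to _≤ᶠ_)
open import Data.Bool using (Bool; true; false; T; _∧_; not)
open import Data.List using (List; length; head; last)
open import Data.Maybe using (just)
open import Data.List.Membership.Propositional using (_∈_)
open import Data.List.Relation.Unary.Linked using (Linked)
open import Data.List.Relation.Unary.Unique.Propositional using (Unique)
open import Data.Product using (Σ; _×_; ∃)
open import Data.Sum using (_⊎_)
open import Relation.Nullary using (¬_; ⌊_⌋)
open import Relation.Binary.PropositionalEquality using (_≡_; _≢_)
open import Function.Definitions using (Injective)

record Graph : Set where
  field
    size   : ℕ
    adj    : Fin size → Fin size → Bool
    sym    : ∀ u v → adj u v ≡ adj v u
    irrefl : ∀ u → adj u u ≡ false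
open Graph public

E : (G : Graph) → Fin (size G) → Fin (size G) → Set
E G u v = T (adj G u v)

-- A linear order on Fin n, given by an injective (hence bijective) rank function:
-- u ≤ v  iff  rank u ≤ rank v.
record LinOrd (n : ℕ) : Set where
  field
    rank     : Fin n → Fin n
    rank-inj : Injective _≡_ _≡_ rank
open LinOrd public

_≤⟨_⟩_ : ∀ {n} → Fin n → LinOrd n → Fin n → Set
u ≤⟨ o ⟩ v = rank o u ≤ᶠ rank o v

VSet : ℕ → Set
VSet n = Fin n → Bool

full : ∀ {n} → VSet n
full _ = true

_minus_ : ∀ {n} → VSet n → Fin n → VSet n
(C minus x) w = C w ∧ not ⌊ w ≟ x ⌋

data Reach (G : Graph) (K : VSet (size G)) : Fin (size G) → Fin (size G) → Set where
  here : ∀ {a} → T (K a) → Reach G K a a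
  step : ∀ {a b c} → Reach G K a b → E G b c → T (K c) → Reach G K a c

Connected : Graph → Set
Connected H = (0 < size H) × (∀ u v → Reach H full u v)

IsMin : (G : Graph) → LinOrd (size G) → VSet (size G) → Fin (size G) → Set
IsMin G o C x = T (C x) × (∀ w → T (C w) → x ≤⟨ o ⟩ w)

IsComponent : (G : Graph) → VSet (size G) → VSet (size G) → Set
IsComponent G D K =
  (∀ a → T (K a) → T (D a)) ×
  (∃ λ a → T (K a)) ×
  (∀ a b → T (K a) → T (K b) → Reach G K a b) ×
  (∀ a b → T (K a) → T (D b) → E G a b → T (K b))

-- Ancestor-or-equal relation in the elimination tree ET(G[C], o), defined following
-- the recursive definition of ET: the root is x = min C; its children are the roots
-- of the elimination trees of the components of G[C] - x.
data Anc (G : Graph) (o : LinOrd (size G)) : VSet (size G) → Fin (size G) → Fin (size G) → Set where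
  root : ∀ {C x v} → IsMin G o C x → T (C v) → Anc G o C x v
  down : ∀ {C x K u v} → IsMin G o C x → IsComponent G (C minus x) K →
         Anc G o K u v → Anc G o C u v

Rel : (H : Graph) → LinOrd (size H) → Fin (size H) → Fin (size H) → Set
Rel H o = Anc H o full

Leaf : (H : Graph) → LinOrd (size H) → Fin (size H) → Set
Leaf H o ℓ = ∀ w → Rel H o ℓ w → w ≡ ℓ

Embedding : (H : Graph) → LinOrd (size H) → (G : Graph) → LinOrd (size G) →
            (Fin (size H) → Fin (size G)) → Set
Embedding H oH G oG φ =
  Injective _≡_ _≡_ φ ×
  (∀ u v → E H u v → E G (φ u) (φ v)) ×
  (∀ u v → E G (φ u) (φ v) → E H u v) ×
  (∀ u v → Rel H oH u v → φ u ≤⟨ oG ⟩ φ v)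

-- A u-v-path in G: a list of pairwise distinct vertices starting at u, ending at v,
-- consecutive vertices adjacent. Its number of edges is length p - 1.
IsPath : (G : Graph) → List (Fin (size G)) → Fin (size G) → Fin (size G) → Set
IsPath G p u v = (head p ≡ just u) × (last p ≡ just v) × Linked (E G) p × Unique p

SOpen : (G : Graph) → LinOrd (size G) → ℕ → Fin (size G) → Fin (size G) → Set
SOpen G o r u v =
  v ≤⟨ o ⟩ u ×
  Σ (List (Fin (size G))) λ p →
    IsPath G p u v × (length p ≤ suc r) × (∀ w → w ∈ p → w ≢ v → u ≤⟨ o ⟩ w)

SClosed : (G : Graph) → LinOrd (size G) → ℕ → Fin (size G) → Fin (size G) → Set
SClosed G o r u v = SOpen G o r u v ⊎ v ≡ u

-- Let ℓ be a descendant of x in ET((H, ≤)), and let C be the vertex set of the subtree rooted at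
-- x, so that x = min C and H[C] is connected. The vertex ℓ lies in a component K of H[C] − x,
-- and y = min K is the child of x above ℓ. Connectivity of H[C] gives a neighbour of x in K, so
-- there is a path from y to x whose vertices other than x lie in K, i.e. are descendants of y.
-- An embedding φ maps those vertices above φ(y) and preserves the path, which has at most |H|
-- vertices; hence φ(x) ∈ S^{|H|}[φ(y)].
module Submission where

open import Defs
open import Data.Fin using (Fin)
open import Data.Product using (Σ; _×_)
open import Relation.Binary.PropositionalEquality using (_≢_)

open import Data.Nat using (ℕ; zero; suc; _+_; _≤_; _<_; _≤?_)
open import Data.Nat.Properties
  using (≤-trans; ≤⇒≯; ≰⇒>; m≤n⇒m≤1+n; m≤n+m; +-identityʳ; +-suc; +-monoˡ-≤)
open import Data.Fin using (zero; suc; _≟_)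
open import Data.Fin.Properties using (any?; pigeonhole; <⇒≢; ≤-totalOrder)
open import Data.Fin.Subset using (∣_∣) renaming (_∈_ to _∈ˢ_)
open import Data.Fin.Subset.Properties using (p⊂q⇒∣p∣<∣q∣; ∣p∣≤n)
open import Data.Bool using (T; _∨_)
open import Data.Bool.Properties using (T-∧; T-∨; T-≡)
open import Data.Empty using (⊥-elim)
open import Data.Product using (_,_; proj₁; proj₂; ∃; ∃₂)
open import Data.Sum using (_⊎_; inj₁; inj₂; [_,_]′)
open import Data.List using (List; []; _∷_; length; map; lookup; filter; allFin; last)
open import Data.List.Properties using (length-map; head-map; last-map)
open import Data.Maybe using (just)
import Data.Maybe as Maybe
open import Data.List.Membership.Propositional using (_∈_)
open import Data.List.Membership.Propositional.Properties
  using (∈-allFin; ∈-map⁻; ∈-lookup; ∈-filter⁺)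
import Data.List.Membership.DecPropositional as DecMembership
open import Data.List.Relation.Unary.Any using (here; there)
open import Data.List.Relation.Unary.All as All using (All; []; _∷_)
open import Data.List.Relation.Unary.All.Properties using (¬Any⇒All¬; all-filter)
open import Data.List.Relation.Unary.AllPairs using ([]; _∷_)
open import Data.List.Relation.Unary.Linked as Linked using ([-]; _∷_)
import Data.List.Relation.Unary.Linked.Properties as Linkedₚ
open import Data.List.Relation.Unary.Unique.Propositional using (Unique)
import Data.List.Relation.Unary.Unique.Propositional.Properties as Uniqueₚ
import Data.List.Extrema as Extrema
open import Data.Vec using (tabulate)
open import Data.Vec.Properties using (lookup∘tabulate; []=⇒lookup; lookup⇒[]=)
open import Function using (_∘_; Injective)
open import Function.Bundles using (Equivalence)
open import Relation.Nullary using (¬_; ⌊_⌋; yes; no; Dec)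
open import Relation.Nullary.Decidable
  using (_×-dec_; ¬?; T?; toWitness; fromWitness; toWitnessFalse; fromWitnessFalse)
open import Relation.Binary.PropositionalEquality as ≡ using (_≡_; refl; trans; cong; subst)

open Equivalence using (to; from)

private
  variable
    n : ℕ

minus⁻ : (C : VSet n) (x : Fin n) {w : Fin n} → T ((C minus x) w) → T (C w) × w ≢ x
minus⁻ C x {w} t = proj₁ (to T-∧ t) , toWitnessFalse {a? = w ≟ x} (proj₂ (to (T-∧ {C w}) t))

minus⁺ : (C : VSet n) (x : Fin n) {w : Fin n} → T (C w) → w ≢ x → T ((C minus x) w)
minus⁺ C x {w} w∈C w≢x = from (T-∧ {C w}) (w∈C , fromWitnessFalse w≢x)

singleton : Fin n → VSet n
singleton b v = ⌊ v ≟ b ⌋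

insert : Fin n → VSet n → VSet n
insert b K v = singleton b v ∨ K v

insert-self : (b : Fin n) (K : VSet n) → T (insert b K b)
insert-self b K = from (T-∨ {⌊ b ≟ b ⌋}) (inj₁ (fromWitness refl))

insert-⊇ : (b : Fin n) (K : VSet n) {v : Fin n} → T (K v) → T (insert b K v)
insert-⊇ b K {v} v∈K = from (T-∨ {⌊ v ≟ b ⌋}) (inj₂ v∈K)

insert⁻ : (b : Fin n) (K : VSet n) {v : Fin n} → T (insert b K v) → v ≡ b ⊎ T (K v)
insert⁻ b K {v} t with to (T-∨ {⌊ v ≟ b ⌋}) t
... | inj₁ v≡b = inj₁ (toWitness v≡b)
... | inj₂ v∈K = inj₂ v∈K

∣_∣ᵛ : VSet n → ℕ
∣ K ∣ᵛ = ∣ tabulate K ∣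

∈-tabulate⁺ : (K : VSet n) {a : Fin n} → T (K a) → a ∈ˢ tabulate K
∈-tabulate⁺ K {a} a∈K = lookup⇒[]= a (tabulate K) (trans (lookup∘tabulate K a) (to T-≡ a∈K))

∈-tabulate⁻ : (K : VSet n) {a : Fin n} → a ∈ˢ tabulate K → T (K a)
∈-tabulate⁻ K {a} a∈K = from T-≡ (trans (≡.sym (lookup∘tabulate K a)) ([]=⇒lookup a∈K))

insert-grows : (b : Fin n) (K : VSet n) → ¬ T (K b) → ∣ K ∣ᵛ < ∣ insert b K ∣ᵛ
insert-grows b K b∉K = p⊂q⇒∣p∣<∣q∣
  ( ∈-tabulate⁺ (insert b K) ∘ insert-⊇ b K ∘ ∈-tabulate⁻ K
  , b , ∈-tabulate⁺ (insert b K) (insert-self b K) , b∉K ∘ ∈-tabulate⁻ K )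

E-sym : (G : Graph) {u v : Fin (size G)} → E G u v → E G v u
E-sym G {u} {v} = subst T (sym G u v)

module _ {G : Graph} where

  reach-inside : {C : VSet (size G)} {a b : Fin (size G)} → Reach G C a b → T (C b)
  reach-inside (here b∈C)    = b∈C
  reach-inside (step _ _ b∈C) = b∈C

  reach-mono : {C C′ : VSet (size G)} {a b : Fin (size G)} →
               (∀ {v} → T (C v) → T (C′ v)) → Reach G C a b → Reach G C′ a b
  reach-mono C⊆C′ (here a∈C)       = here (C⊆C′ a∈C)
  reach-mono C⊆C′ (step r e c∈C) = step (reach-mono C⊆C′ r) e (C⊆C′ c∈C)

  reach-trans : {C : VSet (size G)} {a b c : Fin (size G)} →
                Reach G C a b → Reach G C b c → Reach G C a c
  reach-trans r (here _)         = r
  reach-trans r (step r′ e c∈C) = step (reach-trans r r′) e c∈C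

  reach-sym : {C : VSet (size G)} {a b : Fin (size G)} → Reach G C a b → Reach G C b a
  reach-sym (here a∈C)       = here a∈C
  reach-sym (step r e c∈C) =
    reach-trans (step (here c∈C) (E-sym G e) (reach-inside r)) (reach-sym r)

ConnectedIn : (G : Graph) → VSet (size G) → Set
ConnectedIn G K = ∀ a b → T (K a) → T (K b) → Reach G K a b

-- The component of G[D] containing ℓ is grown from {ℓ} by adding one edge leaving the current
-- set at a time; each step enlarges the set, so at most |G| steps are needed.
module ComponentOf (G : Graph) (D : VSet (size G)) (ℓ : Fin (size G)) where

  record ConnectedFrom (K : VSet (size G)) : Set where
    field
      ⊆D    : ∀ {a} → T (K a) → T (D a)
      ∋ℓ    : T (K ℓ)
      reach : ∀ {a} → T (K a) → Reach G K ℓ a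

  ExitEdge : VSet (size G) → Fin (size G) → Fin (size G) → Set
  ExitEdge K a b = T (K a) × T (D b) × ¬ T (K b) × E G a b

  exitEdge? : (K : VSet (size G)) → Dec (∃₂ (ExitEdge K))
  exitEdge? K = any? λ a → any? λ b →
    T? (K a) ×-dec T? (D b) ×-dec ¬? (T? (K b)) ×-dec T? (adj G a b)

  closed⇒component : {K : VSet (size G)} → ¬ ∃₂ (ExitEdge K) → ConnectedFrom K →
                     IsComponent G D K
  closed⇒component {K} no-exit K-conn =
    (λ _ → ⊆D) , (ℓ , ∋ℓ) ,
    (λ a b a∈K b∈K → reach-trans (reach-sym (reach a∈K)) (reach b∈K)) , closed
    where
    open ConnectedFrom K-conn
    closed : ∀ a b → T (K a) → T (D b) → E G a b → T (K b)
    closed a b a∈K b∈D e with T? (K b)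
    ... | yes b∈K = b∈K
    ... | no  b∉K = ⊥-elim (no-exit (a , b , a∈K , b∈D , b∉K , e))

  extend : {K : VSet (size G)} {a b : Fin (size G)} → ExitEdge K a b → ConnectedFrom K →
           ConnectedFrom (insert b K)
  extend {K} {a} {b} (a∈K , b∈D , _ , e) K-conn = record
    { ⊆D    = λ v∈K′ → [ (λ { refl → b∈D }) , ⊆D ]′ (insert⁻ b K v∈K′)
    ; ∋ℓ    = insert-⊇ b K ∋ℓ
    ; reach = λ v∈K′ → [ (λ { refl → step (reach′ (reach a∈K)) e (insert-self b K) })
                       , (reach′ ∘ reach) ]′ (insert⁻ b K v∈K′)
    }
    where
    open ConnectedFrom K-conn
    reach′ : ∀ {v} → Reach G K ℓ v → Reach G (insert b K) ℓ v
    reach′ = reach-mono (insert-⊇ b K)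

  grow : (fuel : ℕ) (K : VSet (size G)) → size G ≤ ∣ K ∣ᵛ + fuel → ConnectedFrom K →
         Σ (VSet (size G)) λ K′ → IsComponent G D K′ × T (K′ ℓ)
  grow fuel K bound K-conn with exitEdge? K
  ... | no no-exit = K , closed⇒component no-exit K-conn , ConnectedFrom.∋ℓ K-conn
  ... | yes (a , b , exit@(_ , _ , b∉K , _)) with fuel
  ...   | zero =
    ⊥-elim (≤⇒≯ (≤-trans (∣p∣≤n (tabulate (insert b K))) n≤∣K∣) (insert-grows b K b∉K))
    where
    n≤∣K∣ : size G ≤ ∣ K ∣ᵛ
    n≤∣K∣ = subst (size G ≤_) (+-identityʳ ∣ K ∣ᵛ) bound
  ...   | suc fuel′ = grow fuel′ (insert b K) bound′ (extend exit K-conn)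
    where
    bound′ : size G ≤ ∣ insert b K ∣ᵛ + fuel′
    bound′ = ≤-trans bound (subst (_≤ ∣ insert b K ∣ᵛ + fuel′) (≡.sym (+-suc ∣ K ∣ᵛ fuel′))
                                   (+-monoˡ-≤ fuel′ (insert-grows b K b∉K)))

  component : T (D ℓ) → Σ (VSet (size G)) λ K → IsComponent G D K × T (K ℓ)
  component ℓ∈D = grow (size G) (singleton ℓ) (m≤n+m (size G) _) record
    { ⊆D    = λ v∈K → subst (T ∘ D) (≡.sym (toWitness v∈K)) ℓ∈D
    ; ∋ℓ    = fromWitness refl
    ; reach = λ v∈K → subst (Reach G (singleton ℓ) ℓ) (≡.sym (toWitness v∈K))
                            (here (fromWitness refl))
    }

minimum : (G : Graph) (o : LinOrd (size G)) {C : VSet (size G)} {a : Fin (size G)} →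
          T (C a) → Σ (Fin (size G)) (IsMin G o C)
minimum G o {C} {a} a∈C =
  argmin (rank o) a members ,
  argmin-all (rank o) a∈C (all-filter (T? ∘ C) (allFin _)) ,
  λ w w∈C → All.lookup (f[argmin]≤f[xs] a members) (∈-filter⁺ (T? ∘ C) (∈-allFin w) w∈C)
  where
  open Extrema (≤-totalOrder (size G))
  members : List (Fin (size G))
  members = filter (T? ∘ C) (allFin _)

record Subtree (H : Graph) (o : LinOrd (size H)) (D : VSet (size H)) (u v : Fin (size H)) : Set where
  field
    vertices  : VSet (size H)
    root-min  : IsMin H o vertices u
    ∋v        : T (vertices v)
    connected : ConnectedIn H vertices
    Anc-lift  : ∀ {a b} → Anc H o vertices a b → Anc H o D a b

Anc⇒Subtree : {H : Graph} {o : LinOrd (size H)} {D : VSet (size H)} {u v : Fin (size H)} →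
              ConnectedIn H D → Anc H o D u v → Subtree H o D u v
Anc⇒Subtree D-conn (root u-min v∈D) = record
  { vertices = _ ; root-min = u-min ; ∋v = v∈D ; connected = D-conn ; Anc-lift = λ a≼b → a≼b }
Anc⇒Subtree D-conn (down x-min K-comp@(_ , _ , K-conn , _) u≼v) = record
  { vertices = vertices ; root-min = root-min ; ∋v = ∋v ; connected = connected
  ; Anc-lift = down x-min K-comp ∘ Anc-lift }
  where open Subtree (Anc⇒Subtree K-conn u≼v)

-- Walking back from b, the walk stays in K, which is closed in H[C] − x, until it steps off x.
neighbour-in-component : {G : Graph} {C K : VSet (size G)} {x b : Fin (size G)} →
                         IsComponent G (C minus x) K → Reach G C x b → T (K b) →
                         ∃ λ w → T (K w) × E G x w
neighbour-in-component {C = C} {x = x} (K⊆ , _) (here _) x∈K =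
  ⊥-elim (proj₂ (minus⁻ C x (K⊆ x x∈K)) refl)
neighbour-in-component {G} {C} {x = x} K-comp@(_ , _ , _ , closed) (step {b = a} {c = b} r e _) b∈K
  with a ≟ x
... | yes refl = b , b∈K , e
... | no  a≢x  = neighbour-in-component K-comp r
                   (closed b a b∈K (minus⁺ C x (reach-inside r) a≢x) (E-sym G e))

record PathIn (G : Graph) (C : VSet (size G)) (u v : Fin (size G)) : Set where
  field
    vertices : List (Fin (size G))
    isPath   : IsPath G vertices u v
    inside   : All (T ∘ C) vertices

module _ {G : Graph} {C : VSet (size G)} where

  suffix-path : {c v : Fin (size G)} (xs : List (Fin (size G))) → c ∈ xs →
                Linked.Linked (E G) xs → Unique xs → All (T ∘ C) xs → last xs ≡ just v →
                PathIn G C c v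
  suffix-path xs (here refl) linked unique inside end =
    record { vertices = xs ; isPath = refl , end , linked , unique ; inside = inside }
  suffix-path (_ ∷ xs@(_ ∷ _)) (there c∈xs) linked (_ ∷ unique) (_ ∷ inside) end =
    suffix-path xs c∈xs (Linked.tail linked) unique inside end

  -- A walk becomes a path by cutting out every closed detour as soon as it appears.
  reach⇒path : {u v : Fin (size G)} → Reach G C u v → PathIn G C v u
  reach⇒path (here u∈C) =
    record { vertices = _ ∷ [] ; isPath = refl , refl , [-] , [] ∷ [] ; inside = u∈C ∷ [] }
  reach⇒path (step {c = c} r e c∈C) with reach⇒path r
  ... | record { vertices = [] ; isPath = () , _ }
  ... | record { vertices = xs@(b ∷ _) ; isPath = refl , end , linked , unique ; inside = inside }
    with DecMembership._∈?_ _≟_ c xs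
  ...   | yes c∈xs = suffix-path xs c∈xs linked unique inside end
  ...   | no  c∉xs = record
    { vertices = c ∷ xs
    ; isPath   = refl , end , E-sym G e ∷ linked , ¬Any⇒All¬ xs c∉xs ∷ unique
    ; inside   = c∈C ∷ inside
    }

Unique-lookup-injective : {A : Set} (xs : List A) → Unique xs →
                          ∀ i j → lookup xs i ≡ lookup xs j → i ≡ j
Unique-lookup-injective (_ ∷ _)  _            zero    zero    _  = refl
Unique-lookup-injective (_ ∷ xs) (x∉xs ∷ _)   zero    (suc j) eq =
  ⊥-elim (All.lookup x∉xs (∈-lookup j) eq)
Unique-lookup-injective (_ ∷ xs) (x∉xs ∷ _)   (suc i) zero    eq =
  ⊥-elim (All.lookup x∉xs (∈-lookup i) (≡.sym eq))
Unique-lookup-injective (_ ∷ xs) (_ ∷ unique) (suc i) (suc j) eq =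
  cong suc (Unique-lookup-injective xs unique i j eq)

Unique⇒length≤ : (xs : List (Fin n)) → Unique xs → length xs ≤ n
Unique⇒length≤ {n} xs unique with length xs ≤? n
... | yes ≤n = ≤n
... | no  ≰n with pigeonhole (≰⇒> ≰n) (lookup xs)
...   | i , j , i<j , eq = ⊥-elim (<⇒≢ i<j (Unique-lookup-injective xs unique i j eq))

IsPath-map : {H G : Graph} (φ : Fin (size H) → Fin (size G)) → Injective _≡_ _≡_ φ →
             (∀ a b → E H a b → E G (φ a) (φ b)) →
             {p : List (Fin (size H))} {u v : Fin (size H)} →
             IsPath H p u v → IsPath G (map φ p) (φ u) (φ v)
IsPath-map φ φ-inj φ-edge {p} (start , end , linked , unique) =
  trans (head-map p) (cong (Maybe.map φ) start) ,
  trans (last-map φ p) (cong (Maybe.map φ) end) ,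
  Linkedₚ.map⁺ (Linked.map (φ-edge _ _) linked) ,
  Uniqueₚ.map⁺ φ-inj unique

embedded-path⇒SOpen : {H G : Graph} {oH : LinOrd (size H)} {oG : LinOrd (size G)}
                      (φ : Fin (size H) → Fin (size G)) → Embedding H oH G oG φ →
                      {x y : Fin (size H)} → Rel H oH x y →
                      (p : List (Fin (size H))) → IsPath H p y x →
                      All (λ v → v ≢ x → Rel H oH y v) p →
                      SOpen G oG (size H) (φ y) (φ x)
embedded-path⇒SOpen {H} {G} {oG = oG} φ (φ-inj , φ-edge , _ , φ-mono) {x} {y}
                    x≼y p p-path below-y =
  φ-mono x y x≼y , map φ p , IsPath-map {H} {G} φ φ-inj φ-edge p-path , length-bound , above-φy
  where
  length-bound : length (map φ p) ≤ suc (size H)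
  length-bound = subst (_≤ suc (size H)) (≡.sym (length-map φ p))
                       (m≤n⇒m≤1+n (Unique⇒length≤ p (proj₂ (proj₂ (proj₂ p-path)))))
  above-φy : ∀ w → w ∈ map φ p → w ≢ φ x → φ y ≤⟨ oG ⟩ w
  above-φy _ w∈φp w≢φx with ∈-map⁻ φ w∈φp
  ... | v , v∈p , refl = φ-mono y v (All.lookup below-y v∈p (w≢φx ∘ cong φ))

module ChildTowards (H : Graph) (H-conn : ∀ u v → Reach H full u v) (o : LinOrd (size H))
                    {x ℓ : Fin (size H)} (x≼ℓ : Rel H o x ℓ) (x≢ℓ : x ≢ ℓ) where

  open Subtree (Anc⇒Subtree (λ a b _ _ → H-conn a b) x≼ℓ) renaming (vertices to C)

  component-of-ℓ : Σ (VSet (size H)) λ K → IsComponent H (C minus x) K × T (K ℓ)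
  component-of-ℓ = ComponentOf.component H (C minus x) ℓ (minus⁺ C x ∋v (x≢ℓ ∘ ≡.sym))

  K : VSet (size H)
  K = proj₁ component-of-ℓ

  K-component : IsComponent H (C minus x) K
  K-component = proj₁ (proj₂ component-of-ℓ)

  ℓ∈K : T (K ℓ)
  ℓ∈K = proj₂ (proj₂ component-of-ℓ)

  y : Fin (size H)
  y = proj₁ (minimum H o {K} ℓ∈K)

  y-min : IsMin H o K y
  y-min = proj₂ (minimum H o {K} ℓ∈K)

  y∈C∖x : T (C y) × y ≢ x
  y∈C∖x = minus⁻ C x (proj₁ K-component y (proj₁ y-min))

  x≼y : Rel H o x y
  x≼y = Anc-lift (root root-min (proj₁ y∈C∖x))

  x≢y : x ≢ y
  x≢y = proj₂ y∈C∖x ∘ ≡.sym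

  y≼K : ∀ {v} → T (K v) → Rel H o y v
  y≼K v∈K = Anc-lift (down root-min K-component (root y-min v∈K))

  path-y-x : PathIn H (insert x K) y x
  path-y-x = reach⇒path (reach-trans (step (here (insert-self x K)) x-w (insert-⊇ x K w∈K))
                                     (reach-mono (insert-⊇ x K) (K-conn w y w∈K (proj₁ y-min))))
    where
    K-conn : ConnectedIn H K
    K-conn = proj₁ (proj₂ (proj₂ K-component))
    neighbour : ∃ λ w → T (K w) × E H x w
    neighbour = neighbour-in-component K-component (connected x ℓ (proj₁ root-min) ∋v) ℓ∈K
    w : Fin (size H)
    w = proj₁ neighbour
    w∈K : T (K w)
    w∈K = proj₁ (proj₂ neighbour)
    x-w : E H x w
    x-w = proj₂ (proj₂ neighbour)

  open PathIn path-y-x public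

  below-y : All (λ v → v ≢ x → Rel H o y v) vertices
  below-y = All.map (λ v∈ v≢x → [ ⊥-elim ∘ v≢x , y≼K ]′ (insert⁻ x K v∈)) inside

lemma3 : (H : Graph) → Connected H →
         (G : Graph) (oG : LinOrd (size G)) (oH : LinOrd (size H)) →
         (ℓ : Fin (size H)) → Leaf H oH ℓ →
         (x : Fin (size H)) → Rel H oH x ℓ → x ≢ ℓ →
         Σ (Fin (size H)) λ y →
           Rel H oH x y × x ≢ y × Rel H oH y ℓ ×
           ((φ : Fin (size H) → Fin (size G)) → Embedding H oH G oG φ →
            SClosed G oG (size H) (φ y) (φ x))
lemma3 H (_ , H-conn) G oG oH ℓ _ x x≼ℓ x≢ℓ =
  y , x≼y , x≢y , y≼K ℓ∈K ,
  λ φ φ-emb → inj₁ (embedded-path⇒SOpen {H} {G} {oH} {oG} φ φ-emb x≼y vertices isPath below-y)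
  where open ChildTowards H H-conn oH x≼ℓ x≢ℓ
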